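{- If $\Sigma=(G,\sigma)$ is a distance compatible signed graph, then $\dim(\Sigma)=\dim(-\Sigma)$, where $-\Sigma=(G,-\sigma)$ is the negation of $\Sigma$.
   Context: All graphs are finite, simple and connected. A signed graph is $\Sigma=(G,\sigma)$ with $G=(V,E)$ and $\sigma:E\to\{+1,-1\}$; its negation is $-\Sigma=(G,-\sigma)$. The sign of a path is the product of its edge signs; $d(u,v)$ is the distance in $G$. $\Sigma$ is distance compatible if for all $u,v$ all shortest $u$–$v$ paths have the same sign $\sigma(uv)$; then $d_\Sigma(u,v)=\sigma(uv)d(u,v)$. For an ordered vertex set $W=(w_1,\dots,w_k)$, $r_\Sigma(v|W)=(d_\Sigma(v,w_1),\dots,d_\Sigma(v,w_k))$; $W$ is a resolving set if distinct vertices have distinct representations, and $\dim(\Sigma)$ is the minimum cardinality of a resolving set. (If $\Sigma$ is compatible, so is $-\Sigma$.) -}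

module Defs where

open import Data.Nat using (ℕ; zero; suc; _≤_)
open import Data.Integer using (ℤ; _◃_)
open import Data.Sign using (Sign; opposite) renaming (_*_ to _*ₛ_)
open import Data.Fin using (Fin)
open import Data.Fin.Subset using (Subset; _∈_; ∣_∣)
open import Data.Bool using (Bool; true; false)
open import Data.Product using (Σ; ∃; _×_; _,_)
open import Relation.Binary.PropositionalEquality using (_≡_)
open import Function.Bundles using (_⇔_)

record Graph (n : ℕ) : Set where
  field
    adj     : Fin n → Fin n → Bool
    adj-sym : ∀ u v → adj u v ≡ adj v u
    irrefl  : ∀ u → adj u u ≡ false

-- A signed graph: a graph together with a symmetric edge labelling by signs
-- (the value of sgn on non-adjacent pairs is irrelevant).
record SignedGraph (n : ℕ) : Set where
  field
    graph    : Graph n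
    sgn      : Fin n → Fin n → Sign
    sgn-sym  : ∀ u v → Graph.adj graph u v ≡ true → sgn u v ≡ sgn v u

module _ {n : ℕ} (S : SignedGraph n) where
  open SignedGraph S
  open Graph graph

  data Walk : Fin n → Fin n → ℕ → Sign → Set where
    nil  : ∀ {u} → Walk u u 0 Sign.+
    cons : ∀ {u w v k s} → adj u w ≡ true → Walk w v k s → Walk u v (suc k) (sgn u w *ₛ s)

  Connected : Set
  Connected = ∀ u v → ∃ λ k → ∃ λ s → Walk u v k s

  IsDist : Fin n → Fin n → ℕ → Set
  IsDist u v d = (∃ λ s → Walk u v d s) × (∀ k s → Walk u v k s → d ≤ k)

  -- all shortest u–v walks (necessarily paths) have the same sign
  DistanceCompatible : Set
  DistanceCompatible = ∀ u v d s t → IsDist u v d → Walk u v d s → Walk u v d t → s ≡ t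

  SignedDist : Fin n → Fin n → ℤ → Set
  SignedDist u v z = ∃ λ d → ∃ λ s → IsDist u v d × Walk u v d s × z ≡ (s ◃ d)

  SameRep : Subset n → Fin n → Fin n → Set
  SameRep W u v = ∀ w → w ∈ W → ∀ z z' → SignedDist u w z → SignedDist v w z' → z ≡ z'

  Resolving : Subset n → Set
  Resolving W = ∀ u v → SameRep W u v → u ≡ v

  IsMetricDim : ℕ → Set
  IsMetricDim k = (∃ λ W → Resolving W × ∣ W ∣ ≡ k) × (∀ W → Resolving W → k ≤ ∣ W ∣)

negate : ∀ {n} → SignedGraph n → SignedGraph n
negate S = record
  { graph = SignedGraph.graph S
  ; sgn = λ u v → opposite (SignedGraph.sgn S u v)
  ; sgn-sym = λ u v e → cong-opp (SignedGraph.sgn-sym S u v e)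
  }
  where
    cong-opp : ∀ {a b : Sign} → a ≡ b → opposite a ≡ opposite b
    cong-opp Relation.Binary.PropositionalEquality.refl = Relation.Binary.PropositionalEquality.refl

{-# OPTIONS --safe #-}
module Submission where

-- A walk of length k has, in −Σ, its sign in Σ multiplied by (−1)^k. Hence Σ and −Σ have
-- the same walks and distances, and d_{−Σ}(u,v) = (−1)^{d(u,v)} d_Σ(u,v). As z ↦ (−1)^{∣z∣} z
-- is injective on ℤ, two vertices have equal representations in −Σ iff they do in Σ, so Σ
-- and −Σ have the same resolving sets.

open import Defs
open import Data.Nat using (ℕ; zero; suc)
open import Data.Integer using (_◃_)
open import Data.Integer.Properties using (abs-cong; sign-cong)
open import Data.Sign using (Sign; opposite; _*_)
open import Data.Sign.Properties using (opposite-involutive; opposite-injective)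
open import Data.Product using (_,_)
open import Relation.Binary.PropositionalEquality
open import Function.Bundles using (_⇔_; mk⇔)

opposite^ : ℕ → Sign → Sign
opposite^ zero    s = s
opposite^ (suc k) s = opposite (opposite^ k s)

opposite^-injective : ∀ k {s t} → opposite^ k s ≡ opposite^ k t → s ≡ t
opposite^-injective zero    eq = eq
opposite^-injective (suc k) eq = opposite^-injective k (opposite-injective eq)

opposite-*ˡ : ∀ s t → opposite s * t ≡ opposite (s * t)
opposite-*ˡ Sign.+ t = refl
opposite-*ˡ Sign.- t = sym (opposite-involutive t)

opposite-*ʳ : ∀ s t → s * opposite t ≡ opposite (s * t)
opposite-*ʳ Sign.+ t = refl
opposite-*ʳ Sign.- t = refl

opposite^-*ʳ : ∀ k s t → opposite^ k (s * t) ≡ s * opposite^ k t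
opposite^-*ʳ zero    s t = refl
opposite^-*ʳ (suc k) s t = trans (cong opposite (opposite^-*ʳ k s t)) (sym (opposite-*ʳ s _))

opposite^-◃-injective : ∀ {m n s t} → opposite^ m s ◃ m ≡ opposite^ n t ◃ n → s ◃ m ≡ t ◃ n
opposite^-◃-injective {m} eq with abs-cong eq
opposite^-◃-injective {zero}  eq | refl = refl
opposite^-◃-injective {suc m} eq | refl =
  cong (_◃ suc m) (opposite^-injective (suc m) (sign-cong eq))

variable
  n : ℕ
  S T : SignedGraph n

record _IsNegationOf_ (T S : SignedGraph n) : Set where
  field
    adj-≡ : ∀ u v → Graph.adj (SignedGraph.graph T) u v
                  ≡ Graph.adj (SignedGraph.graph S) u v
    sgn-≡ : ∀ u v → SignedGraph.sgn T u v ≡ opposite (SignedGraph.sgn S u v)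

negate-isNegationOf : (S : SignedGraph n) → negate S IsNegationOf S
negate-isNegationOf S = record { adj-≡ = λ _ _ → refl ; sgn-≡ = λ _ _ → refl }

isNegationOf-sym : T IsNegationOf S → S IsNegationOf T
isNegationOf-sym neg = record
  { adj-≡ = λ u v → sym (adj-≡ u v)
  ; sgn-≡ = λ u v → trans (sym (opposite-involutive _)) (cong opposite (sym (sgn-≡ u v)))
  }
  where open _IsNegationOf_ neg

walk-negation : {S T : SignedGraph n} → T IsNegationOf S →
                ∀ {u v k s} → Walk S u v k s → Walk T u v k (opposite^ k s)
walk-negation neg nil = nil
walk-negation {S = S} {T = T} neg {u} {v} (cons {w = w} {k = k} {s = s} edge p) =
  subst (Walk T u v (suc k)) sign-≡ (cons (trans (adj-≡ u w) edge) (walk-negation neg p))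
  where
    open _IsNegationOf_ neg
    σ = SignedGraph.sgn S u w
    sign-≡ : SignedGraph.sgn T u w * opposite^ k s ≡ opposite^ (suc k) (σ * s)
    sign-≡ = begin
      SignedGraph.sgn T u w * opposite^ k s  ≡⟨ cong (_* opposite^ k s) (sgn-≡ u w) ⟩
      opposite σ * opposite^ k s             ≡⟨ opposite-*ˡ σ (opposite^ k s) ⟩
      opposite (σ * opposite^ k s)           ≡⟨ cong opposite (opposite^-*ʳ k σ s) ⟨
      opposite (opposite^ k (σ * s))         ∎
      where open ≡-Reasoning

isDist-negation : T IsNegationOf S → ∀ {u v d} → IsDist S u v d → IsDist T u v d
isDist-negation neg {d = d} ((s , p) , shortest) =
  (opposite^ d s , walk-negation neg p) ,
  λ k t q → shortest k (opposite^ k t) (walk-negation (isNegationOf-sym neg) q)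

signedDist-negation : T IsNegationOf S → ∀ {u v d s} → IsDist S u v d → Walk S u v d s →
                      SignedDist T u v (opposite^ d s ◃ d)
signedDist-negation neg {d = d} {s} dist p =
  d , opposite^ d s , isDist-negation neg dist , walk-negation neg p , refl

sameRep-reflect : T IsNegationOf S → ∀ {W u v} → SameRep T W u v → SameRep S W u v
sameRep-reflect neg same w w∈W _ _ (_ , _ , dist , p , refl) (_ , _ , dist′ , p′ , refl) =
  opposite^-◃-injective
    (same w w∈W _ _ (signedDist-negation neg dist p) (signedDist-negation neg dist′ p′))

resolving-negation : T IsNegationOf S → ∀ {W} → Resolving S W → Resolving T W
resolving-negation neg resolves u v same = resolves u v (sameRep-reflect neg same)

metricDim-negation : T IsNegationOf S → ∀ {k} → IsMetricDim S k → IsMetricDim T k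
metricDim-negation neg ((W , resolves , size) , minimal) =
  (W , resolving-negation neg resolves , size) ,
  λ W′ resolves′ → minimal W′ (resolving-negation (isNegationOf-sym neg) resolves′)

theorem2p3 : ∀ {n : ℕ} (S : SignedGraph n) → Connected S → DistanceCompatible S →
    ∀ (k : ℕ) → IsMetricDim S k ⇔ IsMetricDim (negate S) k
theorem2p3 S _ _ k = mk⇔ (metricDim-negation neg) (metricDim-negation (isNegationOf-sym neg))
  where
    neg : negate S IsNegationOf S
    neg = negate-isNegationOf S
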